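{- Let $n\ge 2$ and let $BS_n=BS_{n-1}^1\oplus BS_{n-1}^2\oplus\cdots\oplus BS_{n-1}^n$. Then any two vertices lying in different copies $BS_{n-1}^i\neq BS_{n-1}^j$ have at most one common outside neighbour.
   Context: Vertices of the symmetric group $\mathrm{Sym}(n)$ are written as strings $u=u_1u_2\cdots u_n$ (a permutation of $1,\dots,n$), and multiplying $u$ on the right by a transposition $(ij)$ swaps the entries in positions $i$ and $j$. The bubble-sort star graph $BS_n$ is the Cayley graph $\mathrm{Cay}(\mathrm{Sym}(n),T)$ with $T=\{(1i):2\le i\le n\}\cup\{(i,i+1):2\le i\le n-1\}$, where $u$ is adjacent to $u\cdot s$ for $s\in T$. For $i\in[n]$, $BS_{n-1}^i$ is the subgraph induced by the vertices whose $n$-th entry is $i$ (a copy of $BS_{n-1}$); $BS_n=BS_{n-1}^1\oplus\cdots\oplus BS_{n-1}^n$ denotes this decomposition. An outside neighbour of a vertex $u\in V(BS_{n-1}^i)$ is a neighbour of $u$ not in $BS_{n-1}^i$. -}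

module Defs where

open import Data.Nat using (ℕ; suc; _≤_; _<_)
open import Data.Fin using (Fin; toℕ; fromℕ)
open import Data.Vec using (Vec; lookup; _[_]≔_)
open import Data.Product using (Σ; ∃; ∃-syntax; _×_)
open import Data.Sum using (_⊎_)
open import Relation.Binary.PropositionalEquality using (_≡_; _≢_)

-- A permutation u = u₁u₂⋯uₙ of {1,…,n}, written as a string: a vector of
-- length n with entries in Fin n (0-indexed), all entries distinct.
IsPerm : {n : ℕ} → Vec (Fin n) n → Set
IsPerm {n} u = ∀ (i j : Fin n) → lookup u i ≡ lookup u j → i ≡ j

Vertex : ℕ → Set
Vertex n = Σ (Vec (Fin n) n) IsPerm

swap : {n : ℕ} → Vec (Fin n) n → Fin n → Fin n → Vec (Fin n) n
swap u i j = (u [ i ]≔ lookup u j) [ j ]≔ lookup u i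

-- Generating set T of BS_n, 0-indexed positions:
--   (1 i), 2 ≤ i ≤ n   ↦  (0, b) with 1 ≤ b
--   (i i+1), 2 ≤ i ≤ n-1 ↦ (a, a+1) with 1 ≤ a  (a+1 ≤ n-1 is automatic from Fin n)
IsGen : {n : ℕ} → Fin n → Fin n → Set
IsGen a b = (toℕ a ≡ 0 × 1 ≤ toℕ b) ⊎ (1 ≤ toℕ a × toℕ b ≡ suc (toℕ a))

Adj : {n : ℕ} → Vertex n → Vertex n → Set
Adj {n} u w = ∃[ a ] ∃[ b ] (IsGen {n} a b × Σ.proj₁ w ≡ swap (Σ.proj₁ u) a b)

-- The copy BS_{n-1}^i containing u: i is the n-th (last) entry of u.
copy : {m : ℕ} → Vertex (suc m) → Fin (suc m)
copy {m} u = lookup (Σ.proj₁ u) (fromℕ m)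

OutsideNbr : {m : ℕ} → Vertex (suc m) → Vertex (suc m) → Set
OutsideNbr u w = Adj u w × copy w ≢ copy u

module Submission where

-- Write L for the last position (position n of the paper).  The
-- copy of a vertex is its entry at L, and u·(a b) changes that entry only if
-- L ∈ {a, b}.  Every generator (a b) has a < b, so an outside neighbour of u
-- is u·(a L) for a generator (a L); there are at most two such a, namely the
-- first position and the one just before L.
--
-- Now let w₁ = u·(a₁ L) = v·(b₁ L) and w₂ = u·(a₂ L) = v·(b₂ L) be common
-- outside neighbours of u and v, which lie in different copies.  If a₁ = a₂
-- then w₁ = w₂.  Otherwise a₁ ≠ b₁ (else reading position a₁ of w₁ gives
-- u_L = v_L) and likewise a₂ ≠ b₂; since only two positions pair with L this
-- forces b₁ = a₂ and b₂ = a₁.  Reading position L of w₁ and position a₁ of w₂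
-- gives v_{a₂} = u_{a₁} = v_L, contradicting that v is a permutation.

open import Defs
open import Data.Nat using (ℕ; suc; pred; _≤_; _<_)
open import Data.Nat.Properties using (≤-refl; <-≤-trans; <-irrefl)
open import Data.Fin using (Fin; toℕ; fromℕ; _≟_)
open import Data.Fin.Properties using (toℕ-injective; toℕ-fromℕ; toℕ≤pred[n])
open import Data.Vec using (Vec; lookup; _[_]≔_)
open import Data.Vec.Properties using (lookup∘update; lookup∘update′)
open import Data.Product using (Σ; ∃-syntax; _,_; _×_; proj₁; proj₂)
open import Data.Sum using (_⊎_; inj₁; inj₂)
open import Data.Empty using (⊥; ⊥-elim)
open import Relation.Nullary using (yes; no)
open import Relation.Binary.PropositionalEquality

lookup-swap-right : ∀ {n} (u : Vec (Fin n) n) i j → lookup (swap u i j) j ≡ lookup u i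
lookup-swap-right u i j = lookup∘update j (u [ i ]≔ lookup u j) (lookup u i)

lookup-swap-left : ∀ {n} (u : Vec (Fin n) n) i j → i ≢ j →
                   lookup (swap u i j) i ≡ lookup u j
lookup-swap-left u i j i≢j =
  trans (lookup∘update′ i≢j (u [ i ]≔ lookup u j) (lookup u i))
        (lookup∘update i u (lookup u j))

lookup-swap-other : ∀ {n} (u : Vec (Fin n) n) i j p → p ≢ i → p ≢ j →
                    lookup (swap u i j) p ≡ lookup u p
lookup-swap-other u i j p p≢i p≢j =
  trans (lookup∘update′ p≢j (u [ i ]≔ lookup u j) (lookup u i))
        (lookup∘update′ p≢i u (lookup u j))

generator-ordered : ∀ {n} {a b : Fin n} → IsGen a b → toℕ a < toℕ b
generator-ordered (inj₁ (a≡0 , 1≤b)) rewrite a≡0 = 1≤b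
generator-ordered (inj₂ (_ , b≡1+a)) rewrite b≡1+a = ≤-refl

generator-source-not-last : ∀ {m} {a b : Fin (suc m)} → IsGen a b → a ≢ fromℕ m
generator-source-not-last {m} {a} {b} gen refl =
  <-irrefl refl (<-≤-trans (subst (_< toℕ b) (toℕ-fromℕ m) (generator-ordered gen))
                           (toℕ≤pred[n] b))

generator-partner : ∀ {n} {a c : Fin n} → IsGen a c → toℕ a ≡ 0 ⊎ toℕ a ≡ pred (toℕ c)
generator-partner (inj₁ (a≡0 , _))    = inj₁ a≡0
generator-partner (inj₂ (_ , c≡1+a)) = inj₂ (cong pred (sym c≡1+a))

two-values : ∀ {A : Set} {x y p q r : A} →
             (p ≡ x ⊎ p ≡ y) → (q ≡ x ⊎ q ≡ y) → (r ≡ x ⊎ r ≡ y) →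
             p ≢ q → p ≢ r → q ≡ r
two-values (inj₁ refl) (inj₁ refl) _           p≢q _   = ⊥-elim (p≢q refl)
two-values (inj₁ refl) _           (inj₁ refl) _   p≢r = ⊥-elim (p≢r refl)
two-values (inj₂ refl) (inj₂ refl) _           p≢q _   = ⊥-elim (p≢q refl)
two-values (inj₂ refl) _           (inj₂ refl) _   p≢r = ⊥-elim (p≢r refl)
two-values (inj₁ refl) (inj₂ refl) (inj₂ refl) _   _   = refl
two-values (inj₂ refl) (inj₁ refl) (inj₁ refl) _   _   = refl

at-most-two-partners : ∀ {n} {a b d c : Fin n} → IsGen a c → IsGen b c → IsGen d c →
                       a ≢ b → a ≢ d → b ≡ d
at-most-two-partners ga gb gd a≢b a≢d =
  toℕ-injective (two-values (generator-partner ga) (generator-partner gb) (generator-partner gd)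
                            (λ e → a≢b (toℕ-injective e)) (λ e → a≢d (toℕ-injective e)))

-- An outside neighbour of u is u·(a L) for some generator (a L): a swap not
-- touching L keeps the copy, and L cannot be the first position of a generator.
outside⇒swap-last : ∀ {m} (u w : Vertex (suc m)) → OutsideNbr u w →
                    ∃[ a ] (IsGen a (fromℕ m) × proj₁ w ≡ swap (proj₁ u) a (fromℕ m))
outside⇒swap-last {m} u w ((a , b , gen , w≡u·ab) , copy-moved) with b ≟ fromℕ m
... | yes refl = a , gen , w≡u·ab
... | no b≢L   = ⊥-elim (copy-moved (begin
  lookup (proj₁ w) L                ≡⟨ cong (λ x → lookup x L) w≡u·ab ⟩
  lookup (swap (proj₁ u) a b) L     ≡⟨ lookup-swap-other (proj₁ u) a b L L≢a (λ e → b≢L (sym e)) ⟩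
  lookup (proj₁ u) L                ∎))
  where
  open ≡-Reasoning
  L = fromℕ m
  L≢a : L ≢ a
  L≢a e = generator-source-not-last gen (sym e)

equal-swaps⇒equal-entry : ∀ {n} (u v : Vec (Fin n) n) a L → a ≢ L →
                          swap u a L ≡ swap v a L → lookup u L ≡ lookup v L
equal-swaps⇒equal-entry u v a L a≢L eq =
  trans (sym (lookup-swap-left u a L a≢L))
        (trans (cong (λ x → lookup x a) eq) (lookup-swap-left v a L a≢L))

-- The crossed coincidence u·(a L) = v·(b L), u·(b L) = v·(a L) with a, b, L
-- distinct is impossible when v is a permutation: it forces v_b = v_L.
no-crossed-swaps : ∀ {n} (u : Vec (Fin n) n) (v : Vertex n) a b L →
                   a ≢ b → a ≢ L → b ≢ L →
                   swap u a L ≡ swap (proj₁ v) b L → swap u b L ≡ swap (proj₁ v) a L → ⊥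
no-crossed-swaps u (v , v-perm) a b L a≢b a≢L b≢L eq₁ eq₂ = b≢L (v-perm b L vb≡vL)
  where
  open ≡-Reasoning
  vb≡vL : lookup v b ≡ lookup v L
  vb≡vL = begin
    lookup v b                ≡⟨ sym (lookup-swap-right v b L) ⟩
    lookup (swap v b L) L     ≡⟨ cong (λ x → lookup x L) (sym eq₁) ⟩
    lookup (swap u a L) L     ≡⟨ lookup-swap-right u a L ⟩
    lookup u a                ≡⟨ sym (lookup-swap-other u b L a a≢b a≢L) ⟩
    lookup (swap u b L) a     ≡⟨ cong (λ x → lookup x a) eq₂ ⟩
    lookup (swap v a L) a     ≡⟨ lookup-swap-left v a L a≢L ⟩
    lookup v L                ∎

lemma20 : (m : ℕ) → 2 ≤ suc m → (u v : Vertex (suc m)) → copy u ≢ copy v →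
          (w₁ w₂ : Vertex (suc m)) →
          OutsideNbr u w₁ → OutsideNbr v w₁ →
          OutsideNbr u w₂ → OutsideNbr v w₂ →
          Σ.proj₁ w₁ ≡ Σ.proj₁ w₂
lemma20 m _ u v copies-differ w₁ w₂ uw₁ vw₁ uw₂ vw₂
  with outside⇒swap-last u w₁ uw₁ | outside⇒swap-last v w₁ vw₁
     | outside⇒swap-last u w₂ uw₂ | outside⇒swap-last v w₂ vw₂
... | a₁ , ga₁ , w₁≡ua₁ | b₁ , gb₁ , w₁≡vb₁ | a₂ , ga₂ , w₂≡ua₂ | b₂ , gb₂ , w₂≡vb₂
  with a₁ ≟ a₂
... | yes refl = trans w₁≡ua₁ (sym w₂≡ua₂)
... | no a₁≢a₂ = ⊥-elim (no-crossed-swaps U v a₁ a₂ L a₁≢a₂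
                   (generator-source-not-last ga₁) (generator-source-not-last ga₂) crossed₁ crossed₂)
  where
  U = proj₁ u
  V = proj₁ v
  L = fromℕ m
  distinct-partners : ∀ {a b} (w : Vertex (suc m)) → IsGen a L →
                      proj₁ w ≡ swap U a L → proj₁ w ≡ swap V b L → a ≢ b
  distinct-partners w ga w≡ua w≡vb refl =
    copies-differ (equal-swaps⇒equal-entry U V _ L
                    (generator-source-not-last ga) (trans (sym w≡ua) w≡vb))
  b₁≡a₂ : b₁ ≡ a₂
  b₁≡a₂ = sym (at-most-two-partners ga₁ ga₂ gb₁ a₁≢a₂ (distinct-partners w₁ ga₁ w₁≡ua₁ w₁≡vb₁))
  b₂≡a₁ : b₂ ≡ a₁
  b₂≡a₁ = sym (at-most-two-partners ga₂ ga₁ gb₂ (λ e → a₁≢a₂ (sym e)) (distinct-partners w₂ ga₂ w₂≡ua₂ w₂≡vb₂))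
  crossed₁ : swap U a₁ L ≡ swap V a₂ L
  crossed₁ = trans (sym w₁≡ua₁) (subst (λ b → proj₁ w₁ ≡ swap V b L) b₁≡a₂ w₁≡vb₁)
  crossed₂ : swap U a₂ L ≡ swap V a₁ L
  crossed₂ = trans (sym w₂≡ua₂) (subst (λ b → proj₁ w₂ ≡ swap V b L) b₂≡a₁ w₂≡vb₂)
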